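{- Let $P,Q$ be integers with $4Q\notin\{P^2,0\}$, and let $U(P,Q,n)$ and $V(P,Q,n)$ be the Lucas sequences of the first and second kind. There is an integer $c\ge 0$ such that, for every sufficiently large integer $b\ge 2$, the following identities hold for every integer $n\ge 1$: $$U(P,Q,n)=\left\lfloor \frac{c\,b^{n^2+3n}-(cP-1)b^{n^2+2n}+c(Q-1)b^{n^2+n}}{b^{3n}-(c+P)b^{2n}+(cP+Q)b^n-cQ}\right\rfloor \bmod b^n - c^{n+1},$$ $$V(P,Q,n)=\left\lfloor \frac{(c+2)b^{n^2+3n}-(2c+P+cP)b^{n^2+2n}+c(P+Q)b^{n^2+n}}{b^{3n}-(c+P)b^{2n}+(cP+Q)b^n-cQ}\right\rfloor \bmod b^n - c^{n+1}.$$
   Context: For integers $P,Q$, the Lucas sequence of the first kind $U(P,Q,n)$ is defined by $U(P,Q,0)=0$, $U(P,Q,1)=1$, $U(P,Q,n+2)=PU(P,Q,n+1)-QU(P,Q,n)$; the Lucas sequence of the second kind $V(P,Q,n)$ by $V(P,Q,0)=2$, $V(P,Q,1)=P$ and the same recurrence. For $y\ge 1$, $x\bmod y$ is the least non-negative residue of $x$ modulo $y$. -}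

module Defs where

open import Data.Nat as ℕ using (ℕ; zero; suc)
open import Data.Integer using (ℤ; +_; -[1+_]; _+_; _-_; _*_; -_; _/ℕ_; _%ℕ_)

U : ℤ → ℤ → ℕ → ℤ
U P Q zero = + 0
U P Q (suc zero) = + 1
U P Q (suc (suc n)) = P * U P Q (suc n) - Q * U P Q n

V : ℤ → ℤ → ℕ → ℤ
V P Q zero = + 2
V P Q (suc zero) = P
V P Q (suc (suc n)) = P * V P Q (suc n) - Q * V P Q n

⌊_/_⌋ : ℤ → ℤ → ℤ
⌊ a / + zero ⌋ = + 0
⌊ a / + suc k ⌋ = a /ℕ suc k
⌊ a / -[1+ k ] ⌋ = (- a) /ℕ suc k

-- least non-negative residue of x modulo m (m ≥ 1); value 0 for m = 0
_mod_ : ℤ → ℕ → ℕ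
x mod zero = 0
x mod suc k = x %ℕ suc k

-- Put x = b^n. The fraction in the statement is x^n N / D with D = (x - c)(x² - P x + Q), and
-- N / D = Σ_{k ≥ 0} (W k + c^(k+1)) x^(-k) is the generating function of the Lucas sequence W
-- plus a geometric series. Hence x^n N = T D + R, where T is the integer with base-x digits
-- W 0 + c, W 1 + c², …, W n + c^(n+1). Since |W k| ≤ 2 (|P| + |Q| + 1)^k, the choice
-- c = 2 (|P| + |Q| + 1) makes every digit non-negative, and once x ≥ 16 c^(3(n+1)) the digits
-- stay below x and 0 ≤ R < D. So ⌊x^n N / D⌋ = T, and T mod x = W n + c^(n+1).
module Submission where

open import Defs
open import Data.Nat as ℕ using (ℕ; _≥_; zero; suc; z≤n; s≤s; _⊔_)
import Data.Nat.Properties as ℕ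
import Data.Nat.Tactic.RingSolver as ℕ-Solver
open import Data.Integer
  using (ℤ; +_; -[1+_]; 0ℤ; _+_; _-_; _*_; _^_; ∣_∣; _≤_; _<_; _/ℕ_; _%ℕ_; +≤+; +<+; -≤+)
  renaming (suc to sucℤ)
open import Data.Integer.Properties
open import Algebra.Properties.AbelianGroup +-0-abelianGroup using () renaming (∙-cancelˡ to +-cancelˡ-≡)
open import Data.Integer.DivMod using (a≡a%ℕn+[a/ℕn]*n; n%ℕd<d)
open import Data.Integer.Tactic.RingSolver using (solve-∀)
open import Data.Product using (Σ; _×_; _,_; proj₁; proj₂)
open import Relation.Nullary using (contradiction)
open import Relation.Binary.PropositionalEquality
  using (_≡_; _≢_; refl; sym; trans; cong; cong₂; subst; subst₂; module ≡-Reasoning)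

pos-^ : ∀ m n → + (m ℕ.^ n) ≡ (+ m) ^ n
pos-^ m zero    = refl
pos-^ m (suc n) = trans (pos-* m (m ℕ.^ n)) (cong (+ m *_) (pos-^ m n))

^-^-comm : ∀ m a b → (m ℕ.^ a) ℕ.^ b ≡ (m ℕ.^ b) ℕ.^ a
^-^-comm m a b = trans (ℕ.^-*-assoc m a b) (trans (cong (m ℕ.^_) (ℕ.*-comm a b)) (sym (ℕ.^-*-assoc m b a)))

^-*-comm : ∀ i m n → i ^ (m ℕ.* n) ≡ (i ^ n) ^ m
^-*-comm i m n = trans (cong (i ^_) (ℕ.*-comm m n)) (sym (^-*-assoc i n m))

∣i∣≤n⇒i≤n : ∀ {n} i → ∣ i ∣ ℕ.≤ n → i ≤ + n
∣i∣≤n⇒i≤n (+ _)    k≤n = +≤+ k≤n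
∣i∣≤n⇒i≤n -[1+ _ ] _   = -≤+

∣i∣≤n⇒0≤n+i : ∀ {n} i → ∣ i ∣ ℕ.≤ n → 0ℤ ≤ + n + i
∣i∣≤n⇒0≤n+i (+ _)    _   = +≤+ z≤n
∣i∣≤n⇒0≤n+i -[1+ _ ] k<n = subst (0ℤ ≤_) (sym (≤-⊖ k<n)) (+≤+ z≤n)

quotient-≤ : ∀ d {q q′ r r′} → q * + d + r ≡ q′ * + d + r′ → 0ℤ ≤ r → r′ < + d → q ≤ q′
quotient-≤ d {q} {q′} {r} {r′} eq 0≤r r′<d = ≮⇒≥ λ q′<q → <-irrefl (sym eq) (begin-strict
  q′ * + d + r′          <⟨ +-monoʳ-< (q′ * + d) r′<d ⟩
  q′ * + d + + d         ≡⟨ trans (+-comm (q′ * + d) (+ d)) (sym (suc-* q′ (+ d))) ⟩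
  sucℤ q′ * + d          ≤⟨ *-monoʳ-≤-nonNeg (+ d) (i<j⇒suc[i]≤j q′<q) ⟩
  q * + d                ≡⟨ sym (+-identityʳ (q * + d)) ⟩
  q * + d + 0ℤ           ≤⟨ +-monoʳ-≤ (q * + d) 0≤r ⟩
  q * + d + r            ∎)
  where open ≤-Reasoning

divℕ-unique : ∀ n d .{{_ : ℕ.NonZero d}} {q r} → n ≡ q * + d + r → 0ℤ ≤ r → r < + d →
              n /ℕ d ≡ q × + (n %ℕ d) ≡ r
divℕ-unique n d {q} {r} n≡qd+r 0≤r r<d = quotient≡ , remainder≡
  where
  0≤n%d : 0ℤ ≤ + (n %ℕ d)
  0≤n%d = +≤+ z≤n
  n%d<d : + (n %ℕ d) < + d
  n%d<d = +<+ (n%ℕd<d n d)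
  division : n /ℕ d * + d + + (n %ℕ d) ≡ q * + d + r
  division = trans (trans (+-comm (n /ℕ d * + d) (+ (n %ℕ d))) (sym (a≡a%ℕn+[a/ℕn]*n n d))) n≡qd+r
  quotient≡ : n /ℕ d ≡ q
  quotient≡ = ≤-antisym (quotient-≤ d division 0≤n%d r<d) (quotient-≤ d (sym division) 0≤r n%d<d)
  remainder≡ : + (n %ℕ d) ≡ r
  remainder≡ = +-cancelˡ-≡ (q * + d) (+ (n %ℕ d)) r (trans (cong (λ t → t * + d + + (n %ℕ d)) (sym quotient≡)) division)

⌊/⌋-unique : ∀ N D {q r} → N ≡ q * D + r → 0ℤ ≤ r → r < D → ⌊ N / D ⌋ ≡ q
⌊/⌋-unique N (+ zero)  _   0≤r r<0 = contradiction (≤-<-trans 0≤r r<0) (<-irrefl refl)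
⌊/⌋-unique N (+ suc k) {q} eq 0≤r r<D = proj₁ (divℕ-unique N (suc k) {q} eq 0≤r r<D)
⌊/⌋-unique N -[1+ k ]  _   0≤r r<D = contradiction (≤-<-trans 0≤r r<D) λ ()

mod-unique : ∀ S X {q r} → S ≡ q * + X + r → 0ℤ ≤ r → r < + X → + (S mod X) ≡ r
mod-unique S zero    _  0≤r r<0 = contradiction (≤-<-trans 0≤r r<0) (<-irrefl refl)
mod-unique S (suc X) {q} eq 0≤r r<X = proj₂ (divℕ-unique S (suc X) {q} eq 0≤r r<X)

module MonomialBounds (A X : ℕ) .{{_ : ℕ.NonZero A}} .{{_ : ℕ.NonZero X}} where

  record Bounded (k i j : ℕ) (e : ℤ) : Set where
    constructor bounded
    field ∣e∣≤ : ∣ e ∣ ℕ.≤ k ℕ.* (A ℕ.^ i ℕ.* X ℕ.^ j)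

  bounded-weaken : ∀ {k i i′ j j′ e} → i ℕ.≤ i′ → j ℕ.≤ j′ → Bounded k i j e → Bounded k i′ j′ e
  bounded-weaken {k} i≤i′ j≤j′ (bounded e≤) =
    bounded (ℕ.≤-trans e≤ (ℕ.*-monoʳ-≤ k (ℕ.*-mono-≤ (ℕ.^-monoʳ-≤ A i≤i′) (ℕ.^-monoʳ-≤ X j≤j′))))

  bounded-coefficient : ∀ {k k′ i j e} → k ℕ.≤ k′ → Bounded k i j e → Bounded k′ i j e
  bounded-coefficient {i = i} {j} k≤k′ (bounded e≤) =
    bounded (ℕ.≤-trans e≤ (ℕ.*-monoˡ-≤ (A ℕ.^ i ℕ.* X ℕ.^ j) k≤k′))

  private
    bounded-by-sum : ∀ {k l i i′ j j′ a b e} → ∣ e ∣ ℕ.≤ ∣ a ∣ ℕ.+ ∣ b ∣ →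
                     Bounded k i j a → Bounded l i′ j′ b → Bounded (k ℕ.+ l) (i ⊔ i′) (j ⊔ j′) e
    bounded-by-sum {k} {l} {i} {i′} {j} {j′} e≤a+b a≤ b≤ = bounded (ℕ.≤-trans e≤a+b (ℕ.≤-trans
      (ℕ.+-mono-≤ (Bounded.∣e∣≤ (bounded-weaken (ℕ.m≤m⊔n i i′) (ℕ.m≤m⊔n j j′) a≤))
                  (Bounded.∣e∣≤ (bounded-weaken (ℕ.m≤n⊔m i i′) (ℕ.m≤n⊔m j j′) b≤)))
      (ℕ.≤-reflexive (sym (ℕ.*-distribʳ-+ (A ℕ.^ (i ⊔ i′) ℕ.* X ℕ.^ (j ⊔ j′)) k l)))))

  bounded-+ : ∀ {k l i i′ j j′ a b} → Bounded k i j a → Bounded l i′ j′ b →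
              Bounded (k ℕ.+ l) (i ⊔ i′) (j ⊔ j′) (a + b)
  bounded-+ {a = a} {b} = bounded-by-sum (∣i+j∣≤∣i∣+∣j∣ a b)

  bounded-- : ∀ {k l i i′ j j′ a b} → Bounded k i j a → Bounded l i′ j′ b →
              Bounded (k ℕ.+ l) (i ⊔ i′) (j ⊔ j′) (a - b)
  bounded-- {a = a} {b} = bounded-by-sum (∣i-j∣≤∣i∣+∣j∣ a b)

  bounded-* : ∀ {k l i i′ j j′ a b} → Bounded k i j a → Bounded l i′ j′ b →
              Bounded (k ℕ.* l) (i ℕ.+ i′) (j ℕ.+ j′) (a * b)
  bounded-* {k} {l} {i} {i′} {j} {j′} {a} {b} (bounded a≤) (bounded b≤) = bounded (begin
    ∣ a * b ∣                                                       ≡⟨ abs-* a b ⟩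
    ∣ a ∣ ℕ.* ∣ b ∣                                                 ≤⟨ ℕ.*-mono-≤ a≤ b≤ ⟩
    k ℕ.* (A ℕ.^ i ℕ.* X ℕ.^ j) ℕ.* (l ℕ.* (A ℕ.^ i′ ℕ.* X ℕ.^ j′))
      ≡⟨ regroup k l (A ℕ.^ i) (X ℕ.^ j) (A ℕ.^ i′) (X ℕ.^ j′) ⟩
    k ℕ.* l ℕ.* (A ℕ.^ i ℕ.* A ℕ.^ i′ ℕ.* (X ℕ.^ j ℕ.* X ℕ.^ j′))
      ≡⟨ sym (cong₂ (λ u v → k ℕ.* l ℕ.* (u ℕ.* v)) (ℕ.^-distribˡ-+-* A i i′) (ℕ.^-distribˡ-+-* X j j′)) ⟩
    k ℕ.* l ℕ.* (A ℕ.^ (i ℕ.+ i′) ℕ.* X ℕ.^ (j ℕ.+ j′))             ∎)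
    where
    open ℕ.≤-Reasoning
    regroup : ∀ k l u v u′ v′ →
              k ℕ.* (u ℕ.* v) ℕ.* (l ℕ.* (u′ ℕ.* v′)) ≡ k ℕ.* l ℕ.* (u ℕ.* u′ ℕ.* (v ℕ.* v′))
    regroup = ℕ-Solver.solve-∀

  bounded-atom : ∀ {a} → ∣ a ∣ ℕ.≤ A → Bounded 1 1 0 a
  bounded-atom a≤A = bounded (ℕ.≤-trans a≤A (ℕ.≤-reflexive (unit A)))
    where
    unit : ∀ a → a ≡ 1 ℕ.* (a ℕ.* 1 ℕ.* 1)
    unit = ℕ-Solver.solve-∀

  bounded-X : Bounded 1 0 1 (+ X)
  bounded-X = bounded (ℕ.≤-reflexive (unit X))
    where
    unit : ∀ x → x ≡ 1 ℕ.* (1 ℕ.* (x ℕ.* 1))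
    unit = ℕ-Solver.solve-∀

  bounded-1 : Bounded 1 0 0 (+ 1)
  bounded-1 = bounded ℕ.≤-refl

  bounded-absorb : ∀ {k i j e} → 16 ℕ.* A ℕ.^ 3 ℕ.≤ X → k ℕ.≤ 16 → Bounded k (3 ℕ.+ i) j e → Bounded 1 i (suc j) e
  bounded-absorb {k} {i} {j} {e} 16A³≤X k≤16 (bounded e≤) = bounded (begin
    ∣ e ∣                                     ≤⟨ e≤ ⟩
    k ℕ.* (A ℕ.^ (3 ℕ.+ i) ℕ.* X ℕ.^ j)        ≤⟨ ℕ.*-monoˡ-≤ _ k≤16 ⟩
    16 ℕ.* (A ℕ.^ (3 ℕ.+ i) ℕ.* X ℕ.^ j)       ≡⟨ cong (λ t → 16 ℕ.* (t ℕ.* X ℕ.^ j)) (ℕ.^-distribˡ-+-* A 3 i) ⟩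
    16 ℕ.* (A ℕ.^ 3 ℕ.* A ℕ.^ i ℕ.* X ℕ.^ j)   ≡⟨ regroup (A ℕ.^ 3) (A ℕ.^ i) (X ℕ.^ j) ⟩
    16 ℕ.* A ℕ.^ 3 ℕ.* (A ℕ.^ i ℕ.* X ℕ.^ j)   ≤⟨ ℕ.*-monoˡ-≤ _ 16A³≤X ⟩
    X ℕ.* (A ℕ.^ i ℕ.* X ℕ.^ j)                ≡⟨ shift X (A ℕ.^ i) (X ℕ.^ j) ⟩
    1 ℕ.* (A ℕ.^ i ℕ.* (X ℕ.* X ℕ.^ j))        ∎)
    where
    open ℕ.≤-Reasoning
    regroup : ∀ p u v → 16 ℕ.* (p ℕ.* u ℕ.* v) ≡ 16 ℕ.* p ℕ.* (u ℕ.* v)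
    regroup = ℕ-Solver.solve-∀
    shift : ∀ x u v → x ℕ.* (u ℕ.* v) ≡ 1 ℕ.* (u ℕ.* (x ℕ.* v))
    shift = ℕ-Solver.solve-∀

  private
    monomial : ∀ k i j → + (k ℕ.* (A ℕ.^ i ℕ.* X ℕ.^ j)) ≡ + k * ((+ A) ^ i * (+ X) ^ j)
    monomial k i j = trans (pos-* k _) (cong (+ k *_) (trans (pos-* (A ℕ.^ i) (X ℕ.^ j)) (cong₂ _*_ (pos-^ A i) (pos-^ X j))))

  bounded⇒≤ : ∀ {k i j e} → Bounded k i j e → e ≤ + k * ((+ A) ^ i * (+ X) ^ j)
  bounded⇒≤ {k} {i} {j} {e} (bounded e≤) = subst (e ≤_) (monomial k i j) (∣i∣≤n⇒i≤n e e≤)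

  bounded⇒0≤ : ∀ {k i j e} → Bounded k i j e → 0ℤ ≤ + k * ((+ A) ^ i * (+ X) ^ j) + e
  bounded⇒0≤ {k} {i} {j} {e} (bounded e≤) = subst (λ t → 0ℤ ≤ t + e) (monomial k i j) (∣i∣≤n⇒0≤n+i e e≤)

module RemainderBounds (X C A : ℕ) (2≤C : 2 ℕ.≤ C) (C≤A : C ℕ.≤ A) (16A³≤X : 16 ℕ.* A ℕ.^ 3 ℕ.≤ X)
                       (P Q w₀ w₁ : ℤ) (∣P∣≤A : ∣ P ∣ ℕ.≤ A) (∣Q∣≤A : ∣ Q ∣ ℕ.≤ A)
                       (∣w₀∣≤A : ∣ w₀ ∣ ℕ.≤ A) (∣w₁∣≤A : ∣ w₁ ∣ ℕ.≤ A) where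

  private
    instance
      A≢0 : ℕ.NonZero A
      A≢0 = ℕ.>-nonZero (ℕ.≤-trans (s≤s z≤n) (ℕ.≤-trans 2≤C C≤A))
      X≢0 : ℕ.NonZero X
      X≢0 = ℕ.>-nonZero (ℕ.≤-trans (ℕ.m^n>0 A 3) (ℕ.≤-trans (ℕ.m≤n*m (A ℕ.^ 3) 16) 16A³≤X))

  open MonomialBounds A X

  x c a χ remainder : ℤ
  x = + X
  c = + C
  a = + A
  χ = x * x - P * x + Q
  remainder = (x - c) * (w₁ * x - Q * w₀) + c * a * χ

  private
    bP : Bounded 1 1 0 P
    bP = bounded-atom ∣P∣≤A
    bQ : Bounded 1 1 0 Q
    bQ = bounded-atom ∣Q∣≤A
    bw₀ : Bounded 1 1 0 w₀
    bw₀ = bounded-atom ∣w₀∣≤A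
    bw₁ : Bounded 1 1 0 w₁
    bw₁ = bounded-atom ∣w₁∣≤A
    bc : Bounded 1 1 0 c
    bc = bounded-atom C≤A
    ba : Bounded 1 1 0 a
    ba = bounded-atom ℕ.≤-refl

  -- remainder = c a x² + error with |error| ≤ 2 A x² ≤ c a x².
  0≤remainder : 0ℤ ≤ remainder
  0≤remainder = subst (0ℤ ≤_) (sym (split x c a P Q w₀ w₁)) (bounded⇒0≤ (bounded-coefficient 2≤C error))
    where
    split : ∀ x c a P Q w₀ w₁ → (x - c) * (w₁ * x - Q * w₀) + c * a * (x * x - P * x + Q)
          ≡ c * (a * + 1 * (x * (x * + 1))) + (w₁ * (x * x) + (c * Q * w₀ + c * a * Q - (Q * w₀ + c * w₁ + c * a * P) * x))
    split = solve-∀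
    constant : Bounded 2 3 0 (c * Q * w₀ + c * a * Q)
    constant = bounded-+ (bounded-* (bounded-* bc bQ) bw₀) (bounded-* (bounded-* bc ba) bQ)
    linear : Bounded 3 3 0 (Q * w₀ + c * w₁ + c * a * P)
    linear = bounded-+ (bounded-+ (bounded-* bQ bw₀) (bounded-* bc bw₁)) (bounded-* (bounded-* bc ba) bP)
    error : Bounded 2 1 2 (w₁ * (x * x) + (c * Q * w₀ + c * a * Q - (Q * w₀ + c * w₁ + c * a * P) * x))
    error = bounded-+ (bounded-* bw₁ (bounded-* bounded-X bounded-X))
                      (bounded-absorb 16A³≤X (ℕ.m≤m+n 5 11) (bounded-- constant (bounded-* linear bounded-X)))

  -- (x - c) χ - (1 + remainder) = x³ + slack with |slack| ≤ 13 A³ x² ≤ x³.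
  remainder<denominator : remainder < (x - c) * χ
  remainder<denominator =
    suc[i]≤j⇒i<j (0≤i-j⇒j≤i (subst (0ℤ ≤_) (sym (split x c a P Q w₀ w₁)) (bounded⇒0≤ slack)))
    where
    split : ∀ x c a P Q w₀ w₁ → (x - c) * (x * x - P * x + Q) - (+ 1 + ((x - c) * (w₁ * x - Q * w₀) + c * a * (x * x - P * x + Q)))
          ≡ + 1 * (+ 1 * (x * (x * (x * + 1))))
            + ((c * P + Q + Q * w₀ + c * w₁ + c * a * P) * x - (c + P + w₁ + c * a) * (x * x) - (c * Q + c * Q * w₀ + c * a * Q) - + 1)
    split = solve-∀
    linear : Bounded 5 3 0 (c * P + Q + Q * w₀ + c * w₁ + c * a * P)
    linear = bounded-+ (bounded-+ (bounded-+ (bounded-+ (bounded-* bc bP) bQ) (bounded-* bQ bw₀)) (bounded-* bc bw₁))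
                       (bounded-* (bounded-* bc ba) bP)
    quadratic : Bounded 4 2 0 (c + P + w₁ + c * a)
    quadratic = bounded-+ (bounded-+ (bounded-+ bc bP) bw₁) (bounded-* bc ba)
    constant : Bounded 3 3 0 (c * Q + c * Q * w₀ + c * a * Q)
    constant = bounded-+ (bounded-+ (bounded-* bc bQ) (bounded-* (bounded-* bc bQ) bw₀)) (bounded-* (bounded-* bc ba) bQ)
    slack : Bounded 1 0 3 ((c * P + Q + Q * w₀ + c * w₁ + c * a * P) * x - (c + P + w₁ + c * a) * (x * x) - (c * Q + c * Q * w₀ + c * a * Q) - + 1)
    slack = bounded-absorb 16A³≤X (ℕ.m≤m+n 13 3)
      (bounded-- (bounded-- (bounded-- (bounded-* linear bounded-X) (bounded-* quadratic (bounded-* bounded-X bounded-X))) constant) bounded-1)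

  0≤digit : 0ℤ ≤ w₀ + a
  0≤digit = subst (0ℤ ≤_) (swap a w₀) (bounded⇒0≤ bw₀)
    where
    swap : ∀ a w → + 1 * (a * + 1 * + 1) + w ≡ w + a
    swap = solve-∀

  digit<x : w₀ + a < x
  digit<x = suc[i]≤j⇒i<j (subst (+ 1 + (w₀ + a) ≤_) (unit x)
    (bounded⇒≤ (bounded-absorb 16A³≤X (ℕ.m≤m+n 3 13)
      (bounded-weaken {i′ = 3} {j′ = 0} (s≤s z≤n) z≤n (bounded-+ bounded-1 (bounded-+ bw₀ ba))))))
    where
    unit : ∀ x → + 1 * (+ 1 * (x * + 1)) ≡ x
    unit = solve-∀

Recurrence : ℤ → ℤ → (ℕ → ℤ) → Set
Recurrence P Q W = ∀ k → W (suc (suc k)) ≡ P * W (suc k) - Q * W k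

module LucasSeries (P Q c x : ℤ) (W : ℕ → ℤ) where

  χ denominator numerator : ℤ
  χ           = x * x - P * x + Q
  denominator = (x - c) * χ
  numerator   = x * (W 0 * x + W 1 - P * W 0) * (x - c) + c * x * χ

  digit : ℕ → ℤ
  digit k = W k + c ^ suc k

  truncation : ℕ → ℤ
  truncation zero    = digit 0
  truncation (suc n) = x * truncation n + digit (suc n)

  remainder : ℕ → ℤ
  remainder n = (x - c) * (W (suc n) * x - Q * W n) + c * c ^ suc n * χ

  remainder-step : Recurrence P Q W → ∀ n → x * remainder n ≡ digit (suc n) * denominator + remainder (suc n)
  remainder-step rec n = trans (step x c P Q (W n) (W (suc n)) (c ^ suc n))
    (cong (λ w → digit (suc n) * denominator + ((x - c) * (w * x - Q * W (suc n)) + c * c ^ suc (suc n) * χ)) (sym (rec n)))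
    where
    step : ∀ x c P Q w₀ w₁ g → x * ((x - c) * (w₁ * x - Q * w₀) + c * g * (x * x - P * x + Q))
         ≡ (w₁ + c * g) * ((x - c) * (x * x - P * x + Q))
           + ((x - c) * ((P * w₁ - Q * w₀) * x - Q * w₁) + c * (c * g) * (x * x - P * x + Q))
    step = solve-∀

  expansion : Recurrence P Q W → ∀ n → x ^ n * numerator ≡ truncation n * denominator + remainder n
  expansion rec zero    = base x c P Q (W 0) (W 1)
    where
    base : ∀ x c P Q w₀ w₁ → + 1 * (x * (w₀ * x + w₁ - P * w₀) * (x - c) + c * x * (x * x - P * x + Q))
         ≡ (w₀ + c * + 1) * ((x - c) * (x * x - P * x + Q)) + ((x - c) * (w₁ * x - Q * w₀) + c * (c * + 1) * (x * x - P * x + Q))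
    base = solve-∀
  expansion rec (suc n) = begin
    x * x ^ n * numerator                             ≡⟨ *-assoc x (x ^ n) numerator ⟩
    x * (x ^ n * numerator)                           ≡⟨ cong (x *_) (expansion rec n) ⟩
    x * (truncation n * denominator + remainder n)    ≡⟨ distrib x (truncation n) denominator (remainder n) ⟩
    x * truncation n * denominator + x * remainder n  ≡⟨ cong (_+_ (x * truncation n * denominator)) (remainder-step rec n) ⟩
    x * truncation n * denominator + (digit (suc n) * denominator + remainder (suc n))
      ≡⟨ collect (x * truncation n) (digit (suc n)) denominator (remainder (suc n)) ⟩
    truncation (suc n) * denominator + remainder (suc n) ∎
    where
    open ≡-Reasoning
    distrib : ∀ x t d r → x * (t * d + r) ≡ x * t * d + x * r
    distrib = solve-∀
    collect : ∀ s e d r → s * d + (e * d + r) ≡ (s + e) * d + r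
    collect = solve-∀

lucas-growth : ∀ {P Q W} → Recurrence P Q W → ∀ M γ .{{_ : ℕ.NonZero M}} → ∣ P ∣ ℕ.+ ∣ Q ∣ ℕ.≤ M →
               ∣ W 0 ∣ ℕ.≤ γ → ∣ W 1 ∣ ℕ.≤ γ ℕ.* M → ∀ k → ∣ W k ∣ ℕ.≤ γ ℕ.* M ℕ.^ k
lucas-growth {P} {Q} {W} rec M γ P+Q≤M W₀≤ W₁≤ k = proj₁ (consecutive k)
  where
  Grows : ℕ → Set
  Grows k = ∣ W k ∣ ℕ.≤ γ ℕ.* M ℕ.^ k
  next : ∀ k → Grows k → Grows (suc k) → Grows (suc (suc k))
  next k ih₀ ih₁ = begin
    ∣ W (suc (suc k)) ∣                          ≡⟨ cong ∣_∣ (rec k) ⟩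
    ∣ P * W (suc k) - Q * W k ∣                   ≤⟨ ∣i-j∣≤∣i∣+∣j∣ (P * W (suc k)) (Q * W k) ⟩
    ∣ P * W (suc k) ∣ ℕ.+ ∣ Q * W k ∣             ≡⟨ cong₂ ℕ._+_ (abs-* P (W (suc k))) (abs-* Q (W k)) ⟩
    ∣ P ∣ ℕ.* ∣ W (suc k) ∣ ℕ.+ ∣ Q ∣ ℕ.* ∣ W k ∣  ≤⟨ ℕ.+-mono-≤ (ℕ.*-monoʳ-≤ ∣ P ∣ ih₁) (ℕ.*-monoʳ-≤ ∣ Q ∣ ih₀′) ⟩
    ∣ P ∣ ℕ.* t ℕ.+ ∣ Q ∣ ℕ.* t                   ≡⟨ sym (ℕ.*-distribʳ-+ t ∣ P ∣ ∣ Q ∣) ⟩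
    (∣ P ∣ ℕ.+ ∣ Q ∣) ℕ.* t                       ≤⟨ ℕ.*-monoˡ-≤ t P+Q≤M ⟩
    M ℕ.* (γ ℕ.* M ℕ.^ suc k)                     ≡⟨ swap M γ (M ℕ.^ suc k) ⟩
    γ ℕ.* (M ℕ.* M ℕ.^ suc k)                     ∎
    where
    open ℕ.≤-Reasoning
    t = γ ℕ.* M ℕ.^ suc k
    ih₀′ : ∣ W k ∣ ℕ.≤ t
    ih₀′ = ℕ.≤-trans ih₀ (ℕ.*-monoʳ-≤ γ (ℕ.^-monoʳ-≤ M (ℕ.n≤1+n k)))
    swap : ∀ m g u → m ℕ.* (g ℕ.* u) ≡ g ℕ.* (m ℕ.* u)
    swap = ℕ-Solver.solve-∀
  consecutive : ∀ k → Grows k × Grows (suc k)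
  consecutive zero    = ℕ.≤-trans W₀≤ (ℕ.≤-reflexive (sym (ℕ.*-identityʳ γ))) ,
                        ℕ.≤-trans W₁≤ (ℕ.≤-reflexive (cong (γ ℕ.*_) (sym (ℕ.*-identityʳ M))))
  consecutive (suc k) = let (ih₀ , ih₁) = consecutive k in ih₁ , next k ih₀ ih₁

rate offset threshold : ℤ → ℤ → ℕ
rate P Q      = suc (∣ P ∣ ℕ.+ ∣ Q ∣)
offset P Q    = 2 ℕ.* rate P Q
threshold P Q = 16 ℕ.* (offset P Q ℕ.^ 3 ℕ.* offset P Q ℕ.^ 3)

∣P∣≤rate : ∀ P Q → ∣ P ∣ ℕ.≤ rate P Q
∣P∣≤rate P Q = ℕ.≤-trans (ℕ.m≤m+n ∣ P ∣ ∣ Q ∣) (ℕ.n≤1+n _)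

∣Q∣≤rate : ∀ P Q → ∣ Q ∣ ℕ.≤ rate P Q
∣Q∣≤rate P Q = ℕ.≤-trans (ℕ.m≤n+m ∣ Q ∣ ∣ P ∣) (ℕ.n≤1+n _)

rate≤offset : ∀ P Q → rate P Q ℕ.≤ offset P Q
rate≤offset P Q = ℕ.m≤n*m (rate P Q) 2

threshold-sufficient : ∀ P Q b m → b ≥ threshold P Q → 16 ℕ.* (offset P Q ℕ.^ (2 ℕ.+ m)) ℕ.^ 3 ℕ.≤ b ℕ.^ (1 ℕ.+ m)
threshold-sufficient P Q b m b≥B = begin
  16 ℕ.* (C ℕ.^ (2 ℕ.+ m)) ℕ.^ 3    ≡⟨ cong (16 ℕ.*_) (^-^-comm C (2 ℕ.+ m) 3) ⟩
  16 ℕ.* (K ℕ.* (K ℕ.* K ℕ.^ m))    ≡⟨ regroup K (K ℕ.^ m) ⟩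
  16 ℕ.* (K ℕ.* K) ℕ.* K ℕ.^ m      ≤⟨ ℕ.*-mono-≤ b≥B (ℕ.^-monoˡ-≤ m K≤b) ⟩
  b ℕ.* b ℕ.^ m                    ∎
  where
  open ℕ.≤-Reasoning
  C = offset P Q
  K = C ℕ.^ 3
  regroup : ∀ k u → 16 ℕ.* (k ℕ.* (k ℕ.* u)) ≡ 16 ℕ.* (k ℕ.* k) ℕ.* u
  regroup = ℕ-Solver.solve-∀
  K≤b : K ℕ.≤ b
  K≤b = ℕ.≤-trans (ℕ.m≤m*n K K {{ℕ.m^n≢0 C 3}}) (ℕ.≤-trans (ℕ.m≤n*m (K ℕ.* K) 16) b≥B)

lucas-below-offset-power : ∀ P Q W → Recurrence P Q W → ∣ W 0 ∣ ℕ.≤ 2 → ∣ W 1 ∣ ℕ.≤ offset P Q →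
                           ∀ k n → k ℕ.≤ suc n → ∣ W k ∣ ℕ.≤ offset P Q ℕ.^ suc n
lucas-below-offset-power P Q W rec W₀≤ W₁≤ k n k≤1+n = begin
  ∣ W k ∣               ≤⟨ lucas-growth {P} {Q} {W} rec M 2 (ℕ.n≤1+n _) W₀≤ W₁≤ k ⟩
  2 ℕ.* M ℕ.^ k         ≤⟨ ℕ.*-monoʳ-≤ 2 (ℕ.^-monoʳ-≤ M k≤1+n) ⟩
  2 ℕ.* (M ℕ.* M ℕ.^ n) ≡⟨ sym (ℕ.*-assoc 2 M (M ℕ.^ n)) ⟩
  C ℕ.* M ℕ.^ n         ≤⟨ ℕ.*-monoʳ-≤ C (ℕ.^-monoˡ-≤ n (rate≤offset P Q)) ⟩
  C ℕ.* C ℕ.^ n         ∎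
  where
  open ℕ.≤-Reasoning
  M = rate P Q
  C = offset P Q

digit-extraction : ∀ P Q W → Recurrence P Q W →
  ∣ W 0 ∣ ℕ.≤ 2 → ∣ W 1 ∣ ℕ.≤ offset P Q →
  ∀ b → b ≥ threshold P Q → ∀ m →
  let n = suc m
      X = b ℕ.^ n
      x = (+ b) ^ n
      c = + offset P Q
      open LucasSeries P Q c x W
  in W n ≡ + (⌊ x ^ n * numerator / denominator ⌋ mod X) - c ^ suc n
digit-extraction P Q W rec W₀≤ W₁≤ b b≥B m = begin
  W n                                                      ≡⟨ sym (cancel (W n) (c ^ suc n)) ⟩
  digit n - c ^ suc n                                      ≡⟨ cong (_- c ^ suc n) (sym digit≡) ⟩
  + (truncation n mod X) - c ^ suc n                       ≡⟨ cong (λ t → + (t mod X) - c ^ suc n) (sym truncation≡) ⟩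
  + (⌊ x ^ n * numerator / denominator ⌋ mod X) - c ^ suc n ∎
  where
  open ≡-Reasoning
  n = suc m
  X = b ℕ.^ n
  x = (+ b) ^ n
  C = offset P Q
  A = C ℕ.^ suc n
  c = + C
  open LucasSeries P Q c x W

  cancel : ∀ w e → w + e - e ≡ w
  cancel = solve-∀

  2≤C : 2 ℕ.≤ C
  2≤C = ℕ.*-monoʳ-≤ 2 (s≤s z≤n)
  C≤A : C ℕ.≤ A
  C≤A = ℕ.m≤m*n C (C ℕ.^ n) {{ℕ.m^n≢0 C n}}
  ∣P∣≤A : ∣ P ∣ ℕ.≤ A
  ∣P∣≤A = ℕ.≤-trans (∣P∣≤rate P Q) (ℕ.≤-trans (rate≤offset P Q) C≤A)
  ∣Q∣≤A : ∣ Q ∣ ℕ.≤ A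
  ∣Q∣≤A = ℕ.≤-trans (∣Q∣≤rate P Q) (ℕ.≤-trans (rate≤offset P Q) C≤A)
  ∣W∣≤A : ∀ k → k ℕ.≤ suc n → ∣ W k ∣ ℕ.≤ A
  ∣W∣≤A k k≤1+n = lucas-below-offset-power P Q W rec W₀≤ W₁≤ k n k≤1+n

  module Bounds = RemainderBounds X C A 2≤C C≤A (threshold-sufficient P Q b m b≥B)
                                 P Q (W n) (W (suc n)) ∣P∣≤A ∣Q∣≤A (∣W∣≤A n (ℕ.n≤1+n n)) (∣W∣≤A (suc n) ℕ.≤-refl)

  X≡bⁿ : + X ≡ x
  X≡bⁿ = pos-^ b n
  A≡cⁿ⁺¹ : + A ≡ c ^ suc n
  A≡cⁿ⁺¹ = pos-^ C (suc n)

  truncation≡ : ⌊ x ^ n * numerator / denominator ⌋ ≡ truncation n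
  truncation≡ = ⌊/⌋-unique (x ^ n * numerator) denominator (expansion rec n)
    (subst₂ (λ x g → 0ℤ ≤ Remainder x g) X≡bⁿ A≡cⁿ⁺¹ Bounds.0≤remainder)
    (subst₂ (λ x g → Remainder x g < (x - c) * (x * x - P * x + Q)) X≡bⁿ A≡cⁿ⁺¹ Bounds.remainder<denominator)
    where
    Remainder : ℤ → ℤ → ℤ
    Remainder x g = (x - c) * (W (suc n) * x - Q * W n) + c * g * (x * x - P * x + Q)

  digit≡ : + (truncation n mod X) ≡ digit n
  digit≡ = mod-unique (truncation n) X {truncation m}
    (cong (_+ digit n) (trans (*-comm x (truncation m)) (cong (truncation m *_) (sym X≡bⁿ))))
    (subst (λ g → 0ℤ ≤ W n + g) A≡cⁿ⁺¹ Bounds.0≤digit)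
    (subst (λ g → W n + g < + X) A≡cⁿ⁺¹ Bounds.digit<x)

denominator-shape : ∀ (β c P Q : ℤ) n → let x = β ^ n in
  β ^ (3 ℕ.* n) - (c + P) * β ^ (2 ℕ.* n) + (c * P + Q) * β ^ n - c * Q ≡ (x - c) * (x * x - P * x + Q)
denominator-shape β c P Q n rewrite ^-*-comm β 3 n | ^-*-comm β 2 n = cubic (β ^ n) c P Q
  where
  cubic : ∀ x c P Q → x * (x * (x * + 1)) - (c + P) * (x * (x * + 1)) + (c * P + Q) * x - c * Q ≡ (x - c) * (x * x - P * x + Q)
  cubic = solve-∀

U-numerator-shape : ∀ (β c P Q : ℤ) n → let x = β ^ n in
  c * β ^ (n ℕ.* n ℕ.+ 3 ℕ.* n) - (c * P - + 1) * β ^ (n ℕ.* n ℕ.+ 2 ℕ.* n) + c * (Q - + 1) * β ^ (n ℕ.* n ℕ.+ n)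
  ≡ x ^ n * LucasSeries.numerator P Q c x (U P Q)
U-numerator-shape β c P Q n
  rewrite ^-distribˡ-+-* β (n ℕ.* n) (3 ℕ.* n) | ^-distribˡ-+-* β (n ℕ.* n) (2 ℕ.* n) | ^-distribˡ-+-* β (n ℕ.* n) n
        | ^-*-comm β 3 n | ^-*-comm β 2 n | ^-*-comm β n n
  = generating ((β ^ n) ^ n) (β ^ n) c P Q
  where
  generating : ∀ y x c P Q → c * (y * (x * (x * (x * + 1)))) - (c * P - + 1) * (y * (x * (x * + 1))) + c * (Q - + 1) * (y * x)
             ≡ y * (x * (+ 0 * x + + 1 - P * + 0) * (x - c) + c * x * (x * x - P * x + Q))
  generating = solve-∀

V-numerator-shape : ∀ (β c P Q : ℤ) n → let x = β ^ n in
  (c + + 2) * β ^ (n ℕ.* n ℕ.+ 3 ℕ.* n) - (+ 2 * c + P + c * P) * β ^ (n ℕ.* n ℕ.+ 2 ℕ.* n) + c * (P + Q) * β ^ (n ℕ.* n ℕ.+ n)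
  ≡ x ^ n * LucasSeries.numerator P Q c x (V P Q)
V-numerator-shape β c P Q n
  rewrite ^-distribˡ-+-* β (n ℕ.* n) (3 ℕ.* n) | ^-distribˡ-+-* β (n ℕ.* n) (2 ℕ.* n) | ^-distribˡ-+-* β (n ℕ.* n) n
        | ^-*-comm β 3 n | ^-*-comm β 2 n | ^-*-comm β n n
  = generating ((β ^ n) ^ n) (β ^ n) c P Q
  where
  generating : ∀ y x c P Q → (c + + 2) * (y * (x * (x * (x * + 1)))) - (+ 2 * c + P + c * P) * (y * (x * (x * + 1))) + c * (P + Q) * (y * x)
             ≡ y * (x * (+ 2 * x + P - P * + 2) * (x - c) + c * x * (x * x - P * x + Q))
  generating = solve-∀

⌊/⌋-mod-cong : ∀ X {N N′ D D′ e e′ : ℤ} → N ≡ N′ → D ≡ D′ → e ≡ e′ →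
               + (⌊ N / D ⌋ mod X) - e ≡ + (⌊ N′ / D′ ⌋ mod X) - e′
⌊/⌋-mod-cong X refl refl refl = refl

corollary6p3 : (P Q : ℤ) → + 4 * Q ≢ P ^ 2 → + 4 * Q ≢ + 0 →
    Σ ℕ λ c → Σ ℕ λ B → (b : ℕ) → b ≥ 2 → b ≥ B → (n : ℕ) → n ≥ 1 →
      let C = + c
          β = + b
          D = β ^ (3 ℕ.* n) - (C + P) * β ^ (2 ℕ.* n) + (C * P + Q) * β ^ n - C * Q
      in (U P Q n ≡ + (⌊ C * β ^ (n ℕ.* n ℕ.+ 3 ℕ.* n) - (C * P - + 1) * β ^ (n ℕ.* n ℕ.+ 2 ℕ.* n) + C * (Q - + 1) * β ^ (n ℕ.* n ℕ.+ n) / D ⌋ mod (b ℕ.^ n)) - C ^ (n ℕ.+ 1))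
       × (V P Q n ≡ + (⌊ (C + + 2) * β ^ (n ℕ.* n ℕ.+ 3 ℕ.* n) - (+ 2 * C + P + C * P) * β ^ (n ℕ.* n ℕ.+ 2 ℕ.* n) + C * (P + Q) * β ^ (n ℕ.* n ℕ.+ n) / D ⌋ mod (b ℕ.^ n)) - C ^ (n ℕ.+ 1))
corollary6p3 P Q _ _ = offset P Q , threshold P Q , λ where
  b _ b≥B (suc m) _ →
    let n = suc m
        c = + offset P Q
        denominator≡ = sym (denominator-shape (+ b) c P Q n)
        exponent≡    = cong (c ^_) (ℕ.+-comm 1 n)
    in trans (digit-extraction P Q (U P Q) (λ _ → refl) z≤n (s≤s z≤n) b b≥B m)
             (⌊/⌋-mod-cong (b ℕ.^ n) (sym (U-numerator-shape (+ b) c P Q n)) denominator≡ exponent≡)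
     , trans (digit-extraction P Q (V P Q) (λ _ → refl) ℕ.≤-refl (ℕ.≤-trans (∣P∣≤rate P Q) (rate≤offset P Q)) b b≥B m)
             (⌊/⌋-mod-cong (b ℕ.^ n) (sym (V-numerator-shape (+ b) c P Q n)) denominator≡ exponent≡)
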